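{- Let $\mathbf{C}$ be a quasitopos and let $\rho$ be a PBPO rule. (1) There exists a single PBPO$^+$ rule $\tau$ such that $\Rightarrow^{\rho}_{\mathrm{PBPO}^{\hookrightarrow}}=\Rightarrow^{\tau}_{\mathrm{PBPO}^+}$. (2) If the morphism $t_L$ of $\rho$ is a regular monomorphism, then there exists a single PBPO$^+$ rule $\tau$ such that $\Rightarrow^{\rho}_{\mathrm{PBPO}}=\Rightarrow^{\tau}_{\mathrm{PBPO}^+}$.
   Context: A quasitopos is a category with all finite limits and colimits that is locally cartesian closed and has a regular-subobject classifier. PBPO rule $\rho$: spans $L\xleftarrow{l}K\xrightarrow{r}R$ and $L'\xleftarrow{l'}K'\xrightarrow{r'}R'$ with $t_L:L\to L'$, $t_K:K\to K'$, $t_R:R\to R'$ such that $t_Ll=l't_K$ and $t_Rr=r't_K$. PBPO step $G_L\Rightarrow^{\rho,(m,\alpha)}_{\mathrm{PBPO}}G_R$ with $m:L\to G_L$, $\alpha:G_L\to L'$: $t_L=\alpha\circ m$, $G_L\xleftarrow{g_L}G_K\xrightarrow{u'}K'$ is a pullback of $G_L\xrightarrow{\alpha}L'\xleftarrow{l'}K'$, $u:K\to G_K$ is the morphism induced by the pullback with $g_Lu=ml$, $u'u=t_K$, and $G_R$ is a pushout of $G_K\xleftarrow{u}K\xrightarrow{r}R$. $\Rightarrow^{\rho}_{\mathrm{PBPO}}$ is the union over all $m,\alpha$; $\Rightarrow^{\rho}_{\mathrm{PBPO}^{\hookrightarrow}}$ is the union over those $m,\alpha$ with $m$ a regular monomorphism.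 PBPO$^+$ rule $\tau$: $l:K\to L$, $r:K\to R$, $t_L:L\to L'$, $t_K:K\to K'$, $l':K'\to L'$ with $t_L l=l't_K$ a pullback. PBPO$^+$ step with $m:L\to G_L$, $\alpha:G_L\to L'$: $\alpha m=t_L$ and $L\xleftarrow{1_L}L\xrightarrow{m}G_L$ is a pullback of $L\xrightarrow{t_L}L'\xleftarrow{\alpha}G_L$; $G_L\xleftarrow{g_L}G_K\xrightarrow{u'}K'$ is a pullback of $\alpha,l'$; $u:K\to G_K$ is the unique morphism with $u'u=t_K$; $G_R$ is a pushout of $G_K\xleftarrow{u}K\xrightarrow{r}R$. $\Rightarrow^{\tau}_{\mathrm{PBPO}^+}$ is the union over all $m,\alpha$. -}

module Defs where

open import Level using (Level; _⊔_; suc)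
open import Data.Product using (Σ; _×_; _,_; ∃)
open import Relation.Binary using (IsEquivalence)
open import Data.Unit using (⊤)

record Category (o ℓ e : Level) : Set (suc (o ⊔ ℓ ⊔ e)) where
  infix  4 _≈_
  infixr 9 _∘_
  field
    Obj : Set o
    Hom : Obj → Obj → Set ℓ
    _≈_ : ∀ {A B} → Hom A B → Hom A B → Set e
    id  : ∀ {A} → Hom A A
    _∘_ : ∀ {A B C} → Hom B C → Hom A B → Hom A C
    ≈-equiv   : ∀ {A B} → IsEquivalence (_≈_ {A} {B})
    assoc     : ∀ {A B C D} {f : Hom A B} {g : Hom B C} {h : Hom C D} →
                (h ∘ g) ∘ f ≈ h ∘ (g ∘ f)
    identityˡ : ∀ {A B} {f : Hom A B} → id ∘ f ≈ f
    identityʳ : ∀ {A B} {f : Hom A B} → f ∘ id ≈ f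
    ∘-resp-≈  : ∀ {A B C} {f h : Hom B C} {g i : Hom A B} →
                f ≈ h → g ≈ i → f ∘ g ≈ h ∘ i

module _ {o ℓ e : Level} (𝒞 : Category o ℓ e) where
  open Category 𝒞

  ∃!≈ : ∀ {p} {A B} → (Hom A B → Set p) → Set (ℓ ⊔ e ⊔ p)
  ∃!≈ {p} {A} {B} P = Σ (Hom A B) λ u → P u × (∀ (v : Hom A B) → P v → v ≈ u)

  IsPullback : ∀ {A B C P} → Hom A C → Hom B C → Hom P A → Hom P B → Set (o ⊔ ℓ ⊔ e)
  IsPullback {A} {B} {C} {P} f g p₁ p₂ =
    (f ∘ p₁ ≈ g ∘ p₂) ×
    (∀ {X} (h₁ : Hom X A) (h₂ : Hom X B) → f ∘ h₁ ≈ g ∘ h₂ →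
       ∃!≈ (λ u → (p₁ ∘ u ≈ h₁) × (p₂ ∘ u ≈ h₂)))

  IsPushout : ∀ {A B C Q} → Hom C A → Hom C B → Hom A Q → Hom B Q → Set (o ⊔ ℓ ⊔ e)
  IsPushout {A} {B} {C} {Q} f g i₁ i₂ =
    (i₁ ∘ f ≈ i₂ ∘ g) ×
    (∀ {X} (h₁ : Hom A X) (h₂ : Hom B X) → h₁ ∘ f ≈ h₂ ∘ g →
       ∃!≈ (λ u → (u ∘ i₁ ≈ h₁) × (u ∘ i₂ ≈ h₂)))

  IsEqualizer : ∀ {E X Y} → Hom E X → Hom X Y → Hom X Y → Set (o ⊔ ℓ ⊔ e)
  IsEqualizer {E} {X} {Y} m f g =
    (f ∘ m ≈ g ∘ m) ×
    (∀ {Z} (h : Hom Z X) → f ∘ h ≈ g ∘ h → ∃!≈ (λ k → m ∘ k ≈ h))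

  IsRegularMono : ∀ {E X} → Hom E X → Set (o ⊔ ℓ ⊔ e)
  IsRegularMono {E} {X} m =
    Σ Obj λ Y → Σ (Hom X Y) λ f → Σ (Hom X Y) λ g → IsEqualizer m f g

  IsTerminal : Obj → Set (o ⊔ ℓ ⊔ e)
  IsTerminal T = ∀ X → ∃!≈ {A = X} {B = T} (λ _ → ⊤)

  IsInitial : Obj → Set (o ⊔ ℓ ⊔ e)
  IsInitial I = ∀ X → ∃!≈ {A = I} {B = X} (λ _ → ⊤)

  HasFiniteLimits : Set (o ⊔ ℓ ⊔ e)
  HasFiniteLimits =
    (Σ Obj IsTerminal) ×
    (∀ {A B C} (f : Hom A C) (g : Hom B C) →
       Σ Obj λ P → Σ (Hom P A) λ p₁ → Σ (Hom P B) λ p₂ → IsPullback f g p₁ p₂)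

  HasFiniteColimits : Set (o ⊔ ℓ ⊔ e)
  HasFiniteColimits =
    (Σ Obj IsInitial) ×
    (∀ {A B C} (f : Hom C A) (g : Hom C B) →
       Σ Obj λ Q → Σ (Hom A Q) λ i₁ → Σ (Hom B Q) λ i₂ → IsPushout f g i₁ i₂)

  -- Exponential of (Y, y) by (X, x) in the slice over B:
  -- an object (E, ε) over B together with a pullback P of ε and x and an
  -- evaluation ev : P → Y over B, universal among such data.
  IsSliceExponential : ∀ {B X Y E P} (x : Hom X B) (y : Hom Y B) (ε : Hom E B)
    (p₁ : Hom P E) (p₂ : Hom P X) (ev : Hom P Y) → Set (o ⊔ ℓ ⊔ e)
  IsSliceExponential {B} {X} {Y} {E} {P} x y ε p₁ p₂ ev =
    IsPullback ε x p₁ p₂ × (y ∘ ev ≈ ε ∘ p₁) ×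
    (∀ {Z Q} (z : Hom Z B) (q₁ : Hom Q Z) (q₂ : Hom Q X) → IsPullback z x q₁ q₂ →
      (h : Hom Q Y) → y ∘ h ≈ z ∘ q₁ →
      ∃!≈ (λ k → (ε ∘ k ≈ z) ×
                 Σ (Hom Q P) λ k×x → (p₁ ∘ k×x ≈ k ∘ q₁) × (p₂ ∘ k×x ≈ q₂)
                                      × (ev ∘ k×x ≈ h)))

  -- locally cartesian closed: every slice 𝒞/B is cartesian closed
  -- (terminal object of 𝒞/B is id, binary products are pullbacks, which
  -- exist by HasFiniteLimits; here we require exponentials in each slice)
  IsLocallyCartesianClosed : Set (o ⊔ ℓ ⊔ e)
  IsLocallyCartesianClosed =
    ∀ {B X Y} (x : Hom X B) (y : Hom Y B) →
      Σ Obj λ E → Σ (Hom E B) λ ε → Σ Obj λ P → Σ (Hom P E) λ p₁ →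
      Σ (Hom P X) λ p₂ → Σ (Hom P Y) λ ev → IsSliceExponential x y ε p₁ p₂ ev

  HasRegularSubobjectClassifier : Set (o ⊔ ℓ ⊔ e)
  HasRegularSubobjectClassifier =
    Σ Obj λ T → IsTerminal T × Σ Obj λ Ω → Σ (Hom T Ω) λ true →
      IsRegularMono true ×
      (∀ {A X} (m : Hom A X) → IsRegularMono m → (! : Hom A T) →
        ∃!≈ (λ χ → IsPullback χ true m !))

  record IsQuasitopos : Set (o ⊔ ℓ ⊔ e) where
    field
      finiteLimits   : HasFiniteLimits
      finiteColimits : HasFiniteColimits
      lcc            : IsLocallyCartesianClosed
      classifier     : HasRegularSubobjectClassifier

  record PBPORule : Set (o ⊔ ℓ ⊔ e) where
    field
      L K R L' K' R' : Obj
      l  : Hom K L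
      r  : Hom K R
      l' : Hom K' L'
      r' : Hom K' R'
      tL : Hom L L'
      tK : Hom K K'
      tR : Hom R R'
      commL : tL ∘ l ≈ l' ∘ tK
      commR : tR ∘ r ≈ r' ∘ tK

  PBPOStepVia : (ρ : PBPORule) → (GL GR : Obj) →
    Hom (PBPORule.L ρ) GL → Hom GL (PBPORule.L' ρ) → Set (o ⊔ ℓ ⊔ e)
  PBPOStepVia ρ GL GR m α =
    (tL ≈ α ∘ m) ×
    Σ Obj λ GK → Σ (Hom GK GL) λ gL → Σ (Hom GK K') λ u' →
      IsPullback α l' gL u' ×
      Σ (Hom K GK) λ u → (gL ∘ u ≈ m ∘ l) × (u' ∘ u ≈ tK) ×
        Σ (Hom GK GR) λ gR → Σ (Hom R GR) λ w → IsPushout u r gR w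
    where open PBPORule ρ

  PBPOStep : PBPORule → Obj → Obj → Set (o ⊔ ℓ ⊔ e)
  PBPOStep ρ GL GR =
    Σ (Hom (PBPORule.L ρ) GL) λ m → Σ (Hom GL (PBPORule.L' ρ)) λ α →
      PBPOStepVia ρ GL GR m α

  PBPOmonoStep : PBPORule → Obj → Obj → Set (o ⊔ ℓ ⊔ e)
  PBPOmonoStep ρ GL GR =
    Σ (Hom (PBPORule.L ρ) GL) λ m → Σ (Hom GL (PBPORule.L' ρ)) λ α →
      IsRegularMono m × PBPOStepVia ρ GL GR m α

  record PBPO⁺Rule : Set (o ⊔ ℓ ⊔ e) where
    field
      L K R L' K' : Obj
      l  : Hom K L
      r  : Hom K R
      tL : Hom L L'
      tK : Hom K K'
      l' : Hom K' L'
      pb : IsPullback tL l' l tK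

  PBPO⁺Step : PBPO⁺Rule → Obj → Obj → Set (o ⊔ ℓ ⊔ e)
  PBPO⁺Step τ GL GR =
    Σ (Hom L GL) λ m → Σ (Hom GL L') λ α →
      (α ∘ m ≈ tL) × IsPullback tL α id m ×
      Σ Obj λ GK → Σ (Hom GK GL) λ gL → Σ (Hom GK K') λ u' →
        IsPullback α l' gL u' ×
        Σ (Hom K GK) λ u → (u' ∘ u ≈ tK) × (∀ v → u' ∘ v ≈ tK → v ≈ u) ×
          Σ (Hom GK GR) λ gR → Σ (Hom R GR) λ w → IsPushout u r gR w
    where open PBPO⁺Rule τ

  _≐_ : (Obj → Obj → Set (o ⊔ ℓ ⊔ e)) → (Obj → Obj → Set (o ⊔ ℓ ⊔ e)) → Set (o ⊔ ℓ ⊔ e)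
  R₁ ≐ R₂ = ∀ GL GR → (R₁ GL GR → R₂ GL GR) × (R₂ GL GR → R₁ GL GR)

-- In a quasitopos every object A has a partial map classifier η : A → Partial A, a
-- regular mono such that every partial map (d, f) with d a regular mono is the pullback
-- of η along some φ.  Replace ρ by τ with the same L, with interface the pullback K₀ of
-- tL and l', with right-hand side the pushout R⁺ of r along K → K₀, with L' and K'
-- replaced by Partial L ⊗ L' and Partial L ⊗ K', and with tL by ⟨ η , tL ⟩.  A regular
-- mono match m with adherence α becomes a τ-match with adherence ⟨ φ , α ⟩, where φ
-- classifies the partial map (m, id), so that the match square is a pullback.
-- Conversely a τ-match m with adherence α⁺ satisfies (π₁ ∘ α⁺) ∘ m ≈ η, and in a
-- quasitopos m is a regular mono as soon as some α ∘ m is one; η is.  In both directions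
-- the context pullbacks correspond, and the pushouts of ρ and τ differ by pasting with
-- the pushout defining R⁺.  If tL is a regular mono, every PBPO match is one for the
-- same reason, since tL ≈ α ∘ m.

module Submission where

open import Defs
open import Level using (Level; _⊔_)
open import Data.Product using (Σ; _×_; _,_; proj₁; proj₂)
open import Data.Unit using (tt)
open import Relation.Binary using (IsEquivalence; Setoid)
import Relation.Binary.Reasoning.Setoid as SetoidReasoning

module _ {o ℓ e : Level} (𝒞 : Category o ℓ e) where
  open Category 𝒞

  private variable
    A B C D E F G P X Y : Obj

  module ≈ {A B : Obj} = IsEquivalence (≈-equiv {A} {B})

  hom-setoid : Obj → Obj → Setoid ℓ e
  hom-setoid A B = record { Carrier = Hom A B ; _≈_ = _≈_ ; isEquivalence = ≈-equiv }

  module HomReasoning {A B : Obj} = SetoidReasoning (hom-setoid A B)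
  open HomReasoning

  ∘-resp-≈ˡ : {f h : Hom B C} {g : Hom A B} → f ≈ h → f ∘ g ≈ h ∘ g
  ∘-resp-≈ˡ p = ∘-resp-≈ p ≈.refl

  ∘-resp-≈ʳ : {f : Hom B C} {g i : Hom A B} → g ≈ i → f ∘ g ≈ f ∘ i
  ∘-resp-≈ʳ p = ∘-resp-≈ ≈.refl p

  sym-assoc : {f : Hom A B} {g : Hom B C} {h : Hom C D} → h ∘ (g ∘ f) ≈ (h ∘ g) ∘ f
  sym-assoc = ≈.sym assoc

  pullˡ : {f : Hom B C} {g : Hom A B} {h : Hom A C} {k : Hom X A} →
          f ∘ g ≈ h → f ∘ (g ∘ k) ≈ h ∘ k
  pullˡ p = ≈.trans sym-assoc (∘-resp-≈ˡ p)

  pullʳ : {f : Hom B C} {g : Hom A B} {h : Hom A C} {k : Hom C D} →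
          f ∘ g ≈ h → (k ∘ f) ∘ g ≈ k ∘ h
  pullʳ p = ≈.trans assoc (∘-resp-≈ʳ p)

  extendʳ : {f : Hom B C} {g : Hom A B} {h : Hom D C} {k : Hom A D} {x : Hom X A} →
            f ∘ g ≈ h ∘ k → f ∘ (g ∘ x) ≈ h ∘ (k ∘ x)
  extendʳ p = ≈.trans (pullˡ p) assoc

  cancelˡ : {r : Hom B A} {s : Hom A B} {f : Hom X A} → r ∘ s ≈ id → r ∘ (s ∘ f) ≈ f
  cancelˡ p = ≈.trans (pullˡ p) identityˡ

  module Pullback {A B C P : Obj} {f : Hom A C} {g : Hom B C} {p₁ : Hom P A} {p₂ : Hom P B}
                  (pullback : IsPullback 𝒞 f g p₁ p₂) where
    commute : f ∘ p₁ ≈ g ∘ p₂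
    commute = proj₁ pullback

    module _ {X : Obj} (h₁ : Hom X A) (h₂ : Hom X B) (eq : f ∘ h₁ ≈ g ∘ h₂) where
      private
        mediator : ∃!≈ 𝒞 (λ u → (p₁ ∘ u ≈ h₁) × (p₂ ∘ u ≈ h₂))
        mediator = proj₂ pullback h₁ h₂ eq

      universal : Hom X P
      universal = proj₁ mediator

      p₁∘universal≈h₁ : p₁ ∘ universal ≈ h₁
      p₁∘universal≈h₁ = proj₁ (proj₁ (proj₂ mediator))

      p₂∘universal≈h₂ : p₂ ∘ universal ≈ h₂
      p₂∘universal≈h₂ = proj₂ (proj₁ (proj₂ mediator))

      unique : (v : Hom X P) → p₁ ∘ v ≈ h₁ → p₂ ∘ v ≈ h₂ → v ≈ universal
      unique v p q = proj₂ (proj₂ mediator) v (p , q)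

    unique-diagram : {X : Obj} {a b : Hom X P} → p₁ ∘ a ≈ p₁ ∘ b → p₂ ∘ a ≈ p₂ ∘ b → a ≈ b
    unique-diagram {a = a} {b} p q =
      ≈.trans (unique _ _ eq a p q) (≈.sym (unique _ _ eq b ≈.refl ≈.refl))
      where
        eq : f ∘ (p₁ ∘ b) ≈ g ∘ (p₂ ∘ b)
        eq = extendʳ commute

  module Pushout {A B C Q : Obj} {f : Hom C A} {g : Hom C B} {i₁ : Hom A Q} {i₂ : Hom B Q}
                 (pushout : IsPushout 𝒞 f g i₁ i₂) where
    commute : i₁ ∘ f ≈ i₂ ∘ g
    commute = proj₁ pushout

    module _ {X : Obj} (h₁ : Hom A X) (h₂ : Hom B X) (eq : h₁ ∘ f ≈ h₂ ∘ g) where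
      private
        mediator : ∃!≈ 𝒞 (λ u → (u ∘ i₁ ≈ h₁) × (u ∘ i₂ ≈ h₂))
        mediator = proj₂ pushout h₁ h₂ eq

      universal : Hom Q X
      universal = proj₁ mediator

      universal∘i₁≈h₁ : universal ∘ i₁ ≈ h₁
      universal∘i₁≈h₁ = proj₁ (proj₁ (proj₂ mediator))

      universal∘i₂≈h₂ : universal ∘ i₂ ≈ h₂
      universal∘i₂≈h₂ = proj₂ (proj₁ (proj₂ mediator))

      unique : (v : Hom Q X) → v ∘ i₁ ≈ h₁ → v ∘ i₂ ≈ h₂ → v ≈ universal
      unique v p q = proj₂ (proj₂ mediator) v (p , q)

    unique-diagram : {X : Obj} {a b : Hom Q X} → a ∘ i₁ ≈ b ∘ i₁ → a ∘ i₂ ≈ b ∘ i₂ → a ≈ b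
    unique-diagram {a = a} {b} p q =
      ≈.trans (unique _ _ eq a p q) (≈.sym (unique _ _ eq b ≈.refl ≈.refl))
      where
        eq : (b ∘ i₁) ∘ f ≈ (b ∘ i₂) ∘ g
        eq = ≈.trans (pullʳ commute) sym-assoc

  module Equalizer {E X Y : Obj} {m : Hom E X} {f g : Hom X Y}
                   (equalizer : IsEqualizer 𝒞 m f g) where
    equalize : f ∘ m ≈ g ∘ m
    equalize = proj₁ equalizer

    module _ {Z : Obj} (h : Hom Z X) (eq : f ∘ h ≈ g ∘ h) where
      universal : Hom Z E
      universal = proj₁ (proj₂ equalizer h eq)

      m∘universal≈h : m ∘ universal ≈ h
      m∘universal≈h = proj₁ (proj₂ (proj₂ equalizer h eq))

      unique : (v : Hom Z E) → m ∘ v ≈ h → v ≈ universal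
      unique = proj₂ (proj₂ (proj₂ equalizer h eq))

  Mono : Hom A B → Set (o ⊔ ℓ ⊔ e)
  Mono {A} m = ∀ {X} {a b : Hom X A} → m ∘ a ≈ m ∘ b → a ≈ b

  Mono-resp-≈ : {m m' : Hom A B} → m ≈ m' → Mono m' → Mono m
  Mono-resp-≈ m≈m' mono' p = mono' (≈.trans (∘-resp-≈ˡ (≈.sym m≈m')) (≈.trans p (∘-resp-≈ˡ m≈m')))

  Mono-∘ : {f : Hom B C} {g : Hom A B} → Mono f → Mono g → Mono (f ∘ g)
  Mono-∘ f-mono g-mono p = g-mono (f-mono (≈.trans sym-assoc (≈.trans p assoc)))

  section⇒Mono : {r : Hom B A} {s : Hom A B} → r ∘ s ≈ id → Mono s
  section⇒Mono {s = s} rs {a = a} {b} p = begin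
    a               ≈⟨ cancelˡ rs ⟨
    _ ∘ (s ∘ a)     ≈⟨ ∘-resp-≈ʳ p ⟩
    _ ∘ (s ∘ b)     ≈⟨ cancelˡ rs ⟩
    b               ∎

  regularMono⇒Mono : {m : Hom A B} → IsRegularMono 𝒞 m → Mono m
  regularMono⇒Mono {m = m} (_ , f , g , equalizer) {a = a} {b} p =
    ≈.trans (E.unique (m ∘ b) eq a p) (≈.sym (E.unique (m ∘ b) eq b ≈.refl))
    where
      module E = Equalizer equalizer
      eq : f ∘ (m ∘ b) ≈ g ∘ (m ∘ b)
      eq = extendʳ E.equalize

  regularMono-resp-≈ : {m m' : Hom A B} → m ≈ m' → IsRegularMono 𝒞 m' → IsRegularMono 𝒞 m
  regularMono-resp-≈ m≈m' (Y , f , g , equalize , universal) =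
    Y , f , g , ≈.trans (∘-resp-≈ʳ m≈m') (≈.trans equalize (∘-resp-≈ʳ (≈.sym m≈m'))) ,
    λ h eq → let (k , m'k≈h , unique) = universal h eq in
      k , ≈.trans (∘-resp-≈ˡ m≈m') m'k≈h ,
      λ v mv≈h → unique v (≈.trans (∘-resp-≈ˡ (≈.sym m≈m')) mv≈h)

  regularMono-pullback : {f : Hom A C} {g : Hom B C} {p₁ : Hom P A} {p₂ : Hom P B} →
                         IsPullback 𝒞 f g p₁ p₂ → IsRegularMono 𝒞 g → IsRegularMono 𝒞 p₁
  regularMono-pullback {f = f} {g} {p₁} {p₂} pullback g-regular@(Y , a , b , equalizer) =
    Y , a ∘ f , b ∘ f , equalize , universal
    where
      module PB = Pullback pullback
      module E = Equalizer equalizer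

      equalize : (a ∘ f) ∘ p₁ ≈ (b ∘ f) ∘ p₁
      equalize = begin
        (a ∘ f) ∘ p₁   ≈⟨ pullʳ PB.commute ⟩
        a ∘ (g ∘ p₂)   ≈⟨ pullˡ E.equalize ⟩
        (b ∘ g) ∘ p₂   ≈⟨ assoc ⟩
        b ∘ (g ∘ p₂)   ≈⟨ pullʳ PB.commute ⟨
        (b ∘ f) ∘ p₁   ∎

      universal : {Z : Obj} (h : Hom Z _) → (a ∘ f) ∘ h ≈ (b ∘ f) ∘ h →
                  ∃!≈ 𝒞 (λ k → p₁ ∘ k ≈ h)
      universal h eq =
        PB.universal h k f∘h≈g∘k , PB.p₁∘universal≈h₁ h k f∘h≈g∘k ,
        λ v p₁v≈h → PB.unique h k f∘h≈g∘k v p₁v≈h (regularMono⇒Mono g-regular (begin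
          g ∘ (p₂ ∘ v)   ≈⟨ extendʳ PB.commute ⟨
          f ∘ (p₁ ∘ v)   ≈⟨ ∘-resp-≈ʳ p₁v≈h ⟩
          f ∘ h          ≈⟨ f∘h≈g∘k ⟩
          g ∘ k          ∎))
        where
          fh-equalized : a ∘ (f ∘ h) ≈ b ∘ (f ∘ h)
          fh-equalized = ≈.trans sym-assoc (≈.trans eq assoc)
          k : Hom _ _
          k = E.universal (f ∘ h) fh-equalized
          f∘h≈g∘k : f ∘ h ≈ g ∘ k
          f∘h≈g∘k = ≈.sym (E.m∘universal≈h (f ∘ h) fh-equalized)

  pullback-swap : {f : Hom A C} {g : Hom B C} {p₁ : Hom P A} {p₂ : Hom P B} →
                  IsPullback 𝒞 f g p₁ p₂ → IsPullback 𝒞 g f p₂ p₁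
  pullback-swap pullback =
    ≈.sym PB.commute ,
    λ h₂ h₁ eq → PB.universal h₁ h₂ (≈.sym eq) ,
      (PB.p₂∘universal≈h₂ h₁ h₂ (≈.sym eq) , PB.p₁∘universal≈h₁ h₁ h₂ (≈.sym eq)) ,
      λ v (p₂v , p₁v) → PB.unique h₁ h₂ (≈.sym eq) v p₁v p₂v
    where module PB = Pullback pullback

  pullback-id-factor : {t : Hom A C} {α : Hom B C} {m : Hom A B} → IsPullback 𝒞 t α id m →
                       {h₁ : Hom X A} {h₂ : Hom X B} → t ∘ h₁ ≈ α ∘ h₂ → m ∘ h₁ ≈ h₂
  pullback-id-factor {m = m} pullback {h₁} {h₂} eq = begin
    m ∘ h₁                         ≈⟨ ∘-resp-≈ʳ universal≈h₁ ⟨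
    m ∘ PB.universal h₁ h₂ eq      ≈⟨ PB.p₂∘universal≈h₂ h₁ h₂ eq ⟩
    h₂                             ∎
    where
      module PB = Pullback pullback
      universal≈h₁ : PB.universal h₁ h₂ eq ≈ h₁
      universal≈h₁ = ≈.trans (≈.sym identityˡ) (PB.p₁∘universal≈h₁ h₁ h₂ eq)

  --   A --f--> B --h--> E
  --   g        i₁       j₁
  --   C --i₂-> D --j₂-> F
  pushout-glue : {f : Hom A B} {g : Hom A C} {i₁ : Hom B D} {i₂ : Hom C D}
                 {h : Hom B E} {j₁ : Hom E F} {j₂ : Hom D F} →
                 IsPushout 𝒞 f g i₁ i₂ → IsPushout 𝒞 h i₁ j₁ j₂ →
                 IsPushout 𝒞 (h ∘ f) g j₁ (j₂ ∘ i₂)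
  pushout-glue {f = f} {g} {i₁} {i₂} {h} {j₁} {j₂} left right = commute , universal
    where
      module Left = Pushout left
      module Right = Pushout right

      commute : j₁ ∘ (h ∘ f) ≈ (j₂ ∘ i₂) ∘ g
      commute = begin
        j₁ ∘ (h ∘ f)     ≈⟨ pullˡ Right.commute ⟩
        (j₂ ∘ i₁) ∘ f    ≈⟨ pullʳ Left.commute ⟩
        j₂ ∘ (i₂ ∘ g)    ≈⟨ sym-assoc ⟩
        (j₂ ∘ i₂) ∘ g    ∎

      universal : {X : Obj} (x₁ : Hom _ X) (x₂ : Hom _ X) → x₁ ∘ (h ∘ f) ≈ x₂ ∘ g →
                  ∃!≈ 𝒞 (λ c → (c ∘ j₁ ≈ x₁) × (c ∘ (j₂ ∘ i₂) ≈ x₂))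
      universal x₁ x₂ eq =
        c , (Right.universal∘i₁≈h₁ x₁ c₁ c₁-eq , c∘j₂∘i₂≈x₂) ,
        λ c' (c'j₁ , c'j₂i₂) → Right.unique x₁ c₁ c₁-eq c' c'j₁
          (Left.unique (x₁ ∘ h) x₂ left-eq (c' ∘ j₂)
            (begin
              (c' ∘ j₂) ∘ i₁   ≈⟨ pullʳ (≈.sym Right.commute) ⟩
              c' ∘ (j₁ ∘ h)    ≈⟨ pullˡ c'j₁ ⟩
              x₁ ∘ h           ∎)
            (≈.trans assoc c'j₂i₂))
        where
          left-eq : (x₁ ∘ h) ∘ f ≈ x₂ ∘ g
          left-eq = ≈.trans assoc eq
          c₁ : Hom _ _
          c₁ = Left.universal (x₁ ∘ h) x₂ left-eq
          c₁-eq : x₁ ∘ h ≈ c₁ ∘ i₁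
          c₁-eq = ≈.sym (Left.universal∘i₁≈h₁ (x₁ ∘ h) x₂ left-eq)
          c : Hom _ _
          c = Right.universal x₁ c₁ c₁-eq
          c∘j₂∘i₂≈x₂ : c ∘ (j₂ ∘ i₂) ≈ x₂
          c∘j₂∘i₂≈x₂ = ≈.trans sym-assoc (≈.trans (∘-resp-≈ˡ (Right.universal∘i₂≈h₂ x₁ c₁ c₁-eq))
                                                 (Left.universal∘i₂≈h₂ (x₁ ∘ h) x₂ left-eq))

  pushout-unglue : {f : Hom A B} {g : Hom A C} {i₁ : Hom B D} {i₂ : Hom C D}
                   {h : Hom B E} {k : Hom A E} {j₁ : Hom E F} {v : Hom C F} →
                   IsPushout 𝒞 f g i₁ i₂ → IsPushout 𝒞 k g j₁ v → h ∘ f ≈ k →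
                   Σ (Hom D F) λ j₂ → IsPushout 𝒞 h i₁ j₁ j₂
  pushout-unglue {f = f} {g} {i₁} {i₂} {h} {k} {j₁} {v} left outer hf≈k =
    j₂ , ≈.sym j₂i₁≈j₁h , universal
    where
      module Left = Pushout left
      module Outer = Pushout outer

      j₁h-eq : (j₁ ∘ h) ∘ f ≈ v ∘ g
      j₁h-eq = ≈.trans (pullʳ hf≈k) Outer.commute

      j₂ : Hom _ _
      j₂ = Left.universal (j₁ ∘ h) v j₁h-eq

      j₂i₁≈j₁h : j₂ ∘ i₁ ≈ j₁ ∘ h
      j₂i₁≈j₁h = Left.universal∘i₁≈h₁ (j₁ ∘ h) v j₁h-eq

      j₂i₂≈v : j₂ ∘ i₂ ≈ v
      j₂i₂≈v = Left.universal∘i₂≈h₂ (j₁ ∘ h) v j₁h-eq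

      universal : {X : Obj} (x₁ : Hom _ X) (x₂ : Hom _ X) → x₁ ∘ h ≈ x₂ ∘ i₁ →
                  ∃!≈ 𝒞 (λ c → (c ∘ j₁ ≈ x₁) × (c ∘ j₂ ≈ x₂))
      universal x₁ x₂ eq = c , (c∘j₁≈x₁ , c∘j₂≈x₂) ,
        λ c' (c'j₁ , c'j₂) → Outer.unique x₁ (x₂ ∘ i₂) outer-eq c' c'j₁ (begin
          c' ∘ v           ≈⟨ ∘-resp-≈ʳ j₂i₂≈v ⟨
          c' ∘ (j₂ ∘ i₂)   ≈⟨ pullˡ c'j₂ ⟩
          x₂ ∘ i₂          ∎)
        where
          outer-eq : x₁ ∘ k ≈ (x₂ ∘ i₂) ∘ g
          outer-eq = begin
            x₁ ∘ k          ≈⟨ ∘-resp-≈ʳ hf≈k ⟨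
            x₁ ∘ (h ∘ f)    ≈⟨ pullˡ eq ⟩
            (x₂ ∘ i₁) ∘ f   ≈⟨ pullʳ Left.commute ⟩
            x₂ ∘ (i₂ ∘ g)   ≈⟨ sym-assoc ⟩
            (x₂ ∘ i₂) ∘ g   ∎
          c : Hom _ _
          c = Outer.universal x₁ (x₂ ∘ i₂) outer-eq
          c∘j₁≈x₁ : c ∘ j₁ ≈ x₁
          c∘j₁≈x₁ = Outer.universal∘i₁≈h₁ x₁ (x₂ ∘ i₂) outer-eq
          c∘j₂≈x₂ : c ∘ j₂ ≈ x₂
          c∘j₂≈x₂ = Left.unique-diagram
            (begin
              (c ∘ j₂) ∘ i₁   ≈⟨ pullʳ j₂i₁≈j₁h ⟩
              c ∘ (j₁ ∘ h)    ≈⟨ pullˡ c∘j₁≈x₁ ⟩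
              x₁ ∘ h          ≈⟨ eq ⟩
              x₂ ∘ i₁         ∎)
            (begin
              (c ∘ j₂) ∘ i₂   ≈⟨ pullʳ j₂i₂≈v ⟩
              c ∘ v           ≈⟨ Outer.universal∘i₂≈h₂ x₁ (x₂ ∘ i₂) outer-eq ⟩
              x₂ ∘ i₂         ∎)

  module Terminal {T : Obj} (terminal : IsTerminal 𝒞 T) where
    ! : Hom A T
    ! {A} = proj₁ (terminal A)

    !-unique₂ : (f g : Hom A T) → f ≈ g
    !-unique₂ {A} f g = ≈.trans (proj₂ (proj₂ (terminal A)) f tt)
                                (≈.sym (proj₂ (proj₂ (terminal A)) g tt))

  module Products {T : Obj} (terminal : IsTerminal 𝒞 T) (limits : HasFiniteLimits 𝒞) where
    open Terminal terminal

    private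
      product : (A B : Obj) → Σ Obj λ P → Σ (Hom P A) λ p₁ → Σ (Hom P B) λ p₂ →
                IsPullback 𝒞 (! {A}) (! {B}) p₁ p₂
      product A B = proj₂ limits ! !

      module Product {A B : Obj} = Pullback (proj₂ (proj₂ (proj₂ (product A B))))

    infixr 7 _⊗_
    _⊗_ : Obj → Obj → Obj
    A ⊗ B = proj₁ (product A B)

    π₁ : Hom (A ⊗ B) A
    π₁ {A} {B} = proj₁ (proj₂ (product A B))

    π₂ : Hom (A ⊗ B) B
    π₂ {A} {B} = proj₁ (proj₂ (proj₂ (product A B)))

    ⟨_,_⟩ : Hom X A → Hom X B → Hom X (A ⊗ B)
    ⟨ f , g ⟩ = Product.universal f g (!-unique₂ _ _)

    project₁ : {f : Hom X A} {g : Hom X B} → π₁ ∘ ⟨ f , g ⟩ ≈ f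
    project₁ = Product.p₁∘universal≈h₁ _ _ _

    project₂ : {f : Hom X A} {g : Hom X B} → π₂ ∘ ⟨ f , g ⟩ ≈ g
    project₂ = Product.p₂∘universal≈h₂ _ _ _

    ⟨⟩-unique : {f : Hom X A} {g : Hom X B} {h : Hom X (A ⊗ B)} →
                π₁ ∘ h ≈ f → π₂ ∘ h ≈ g → h ≈ ⟨ f , g ⟩
    ⟨⟩-unique = Product.unique _ _ _ _

    ⊗-ext : {a b : Hom X (A ⊗ B)} → π₁ ∘ a ≈ π₁ ∘ b → π₂ ∘ a ≈ π₂ ∘ b → a ≈ b
    ⊗-ext = Product.unique-diagram

    project₁′ : {f : Hom X A} {g : Hom X B} {h : Hom Y X} → π₁ ∘ (⟨ f , g ⟩ ∘ h) ≈ f ∘ h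
    project₁′ = pullˡ project₁

    project₂′ : {f : Hom X A} {g : Hom X B} {h : Hom Y X} → π₂ ∘ (⟨ f , g ⟩ ∘ h) ≈ g ∘ h
    project₂′ = pullˡ project₂

    ⟨⟩-cong₂ : {f f' : Hom X A} {g g' : Hom X B} → f ≈ f' → g ≈ g' → ⟨ f , g ⟩ ≈ ⟨ f' , g' ⟩
    ⟨⟩-cong₂ f≈f' g≈g' = ⟨⟩-unique (≈.trans project₁ f≈f') (≈.trans project₂ g≈g')

    ⟨⟩∘ : {f : Hom X A} {g : Hom X B} {h : Hom Y X} → ⟨ f , g ⟩ ∘ h ≈ ⟨ f ∘ h , g ∘ h ⟩
    ⟨⟩∘ = ⟨⟩-unique project₁′ project₂′

    second : Hom B C → Hom (A ⊗ B) (A ⊗ C)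
    second g = ⟨ π₁ , g ∘ π₂ ⟩

    π₁∘second′ : {g : Hom B C} {h : Hom X (A ⊗ B)} → π₁ ∘ (second g ∘ h) ≈ π₁ ∘ h
    π₁∘second′ = project₁′

    π₂∘second′ : {g : Hom B C} {h : Hom X (A ⊗ B)} → π₂ ∘ (second g ∘ h) ≈ g ∘ (π₂ ∘ h)
    π₂∘second′ = ≈.trans project₂′ assoc

    pullback-⟨⟩ : {f : Hom A C} {g : Hom B C} {p₁ : Hom P A} {p₂ : Hom P B}
                  {f' : Hom A D} {g' : Hom B D} →
                  IsPullback 𝒞 f g p₁ p₂ → f' ∘ p₁ ≈ g' ∘ p₂ →
                  IsPullback 𝒞 ⟨ f , f' ⟩ ⟨ g , g' ⟩ p₁ p₂
    pullback-⟨⟩ {f = f} {g} {p₁} {p₂} {f'} {g'} pullback f'p₁≈g'p₂ =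
      ⊗-ext (≈.trans project₁′ (≈.trans PB.commute (≈.sym project₁′)))
            (≈.trans project₂′ (≈.trans f'p₁≈g'p₂ (≈.sym project₂′))) ,
      λ h₁ h₂ eq → let fh₁≈gh₂ = ≈.trans (≈.sym project₁′) (≈.trans (∘-resp-≈ʳ eq) project₁′) in
        PB.universal h₁ h₂ fh₁≈gh₂ ,
        (PB.p₁∘universal≈h₁ h₁ h₂ fh₁≈gh₂ , PB.p₂∘universal≈h₂ h₁ h₂ fh₁≈gh₂) ,
        λ v (p₁v , p₂v) → PB.unique h₁ h₂ fh₁≈gh₂ v p₁v p₂v
      where module PB = Pullback pullback

    pullback-second : {f : Hom A C} {g : Hom B C} {p₁ : Hom P A} {p₂ : Hom P B} {h : Hom A D} →
                      IsPullback 𝒞 f g p₁ p₂ →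
                      IsPullback 𝒞 ⟨ h , f ⟩ (second g) p₁ ⟨ h ∘ p₁ , p₂ ⟩
    pullback-second {f = f} {g} {p₁} {p₂} {h} pullback = commute , universal
      where
        module PB = Pullback pullback

        commute : ⟨ h , f ⟩ ∘ p₁ ≈ second g ∘ ⟨ h ∘ p₁ , p₂ ⟩
        commute = ⊗-ext (≈.trans project₁′ (≈.sym (≈.trans π₁∘second′ project₁)))
                        (≈.trans project₂′ (≈.trans PB.commute
                          (≈.sym (≈.trans π₂∘second′ (∘-resp-≈ʳ project₂)))))

        universal : {X : Obj} (x : Hom X _) (y : Hom X (_ ⊗ _)) → ⟨ h , f ⟩ ∘ x ≈ second g ∘ y →
                    ∃!≈ 𝒞 (λ v → (p₁ ∘ v ≈ x) × (⟨ h ∘ p₁ , p₂ ⟩ ∘ v ≈ y))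
        universal x y eq = v , (p₁∘v≈x , ⊗-ext
            (begin
              π₁ ∘ (⟨ h ∘ p₁ , p₂ ⟩ ∘ v)   ≈⟨ project₁′ ⟩
              (h ∘ p₁) ∘ v                 ≈⟨ pullʳ p₁∘v≈x ⟩
              h ∘ x                        ≈⟨ hx≈π₁y ⟩
              π₁ ∘ y                       ∎)
            (≈.trans project₂′ (PB.p₂∘universal≈h₂ x (π₂ ∘ y) fx≈gπ₂y))) ,
          λ v' (p₁v' , ⟨⟩v'≈y) → PB.unique x (π₂ ∘ y) fx≈gπ₂y v' p₁v'
            (≈.trans (≈.sym project₂′) (∘-resp-≈ʳ ⟨⟩v'≈y))
          where
            hx≈π₁y : h ∘ x ≈ π₁ ∘ y
            hx≈π₁y = ≈.trans (≈.sym project₁′) (≈.trans (∘-resp-≈ʳ eq) π₁∘second′)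
            fx≈gπ₂y : f ∘ x ≈ g ∘ (π₂ ∘ y)
            fx≈gπ₂y = ≈.trans (≈.sym project₂′) (≈.trans (∘-resp-≈ʳ eq) π₂∘second′)
            v : Hom _ _
            v = PB.universal x (π₂ ∘ y) fx≈gπ₂y
            p₁∘v≈x : p₁ ∘ v ≈ x
            p₁∘v≈x = PB.p₁∘universal≈h₁ x (π₂ ∘ y) fx≈gπ₂y

    pullback-second⁻¹ : {f : Hom A (D ⊗ B)} {g : Hom C B} {p₁ : Hom P A} {p₂ : Hom P (D ⊗ C)} →
                        IsPullback 𝒞 f (second g) p₁ p₂ → IsPullback 𝒞 (π₂ ∘ f) g p₁ (π₂ ∘ p₂)
    pullback-second⁻¹ {f = f} {g} {p₁} {p₂} pullback =
      ≈.trans (pullʳ PB.commute) π₂∘second′ , universal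
      where
        module PB = Pullback pullback

        universal : {X : Obj} (x : Hom X _) (k : Hom X _) → (π₂ ∘ f) ∘ x ≈ g ∘ k →
                    ∃!≈ 𝒞 (λ v → (p₁ ∘ v ≈ x) × ((π₂ ∘ p₂) ∘ v ≈ k))
        universal x k eq = v , (PB.p₁∘universal≈h₁ x y fx≈y , π₂p₂v≈k) ,
          λ v' (p₁v' , π₂p₂v') → PB.unique x y fx≈y v' p₁v' (⊗-ext
            (begin
              π₁ ∘ (p₂ ∘ v')            ≈⟨ π₁∘second′ ⟨
              π₁ ∘ (second g ∘ p₂ ∘ v')  ≈⟨ ∘-resp-≈ʳ (extendʳ PB.commute) ⟨
              π₁ ∘ (f ∘ p₁ ∘ v')         ≈⟨ ∘-resp-≈ʳ (∘-resp-≈ʳ p₁v') ⟩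
              π₁ ∘ (f ∘ x)               ≈⟨ project₁ ⟨
              π₁ ∘ y                     ∎)
            (≈.trans sym-assoc (≈.trans π₂p₂v' (≈.sym project₂))))
          where
            y : Hom _ _
            y = ⟨ π₁ ∘ (f ∘ x) , k ⟩
            fx≈y : f ∘ x ≈ second g ∘ y
            fx≈y = ⊗-ext (≈.sym (≈.trans π₁∘second′ project₁))
              (begin
                π₂ ∘ (f ∘ x)         ≈⟨ sym-assoc ⟩
                (π₂ ∘ f) ∘ x         ≈⟨ eq ⟩
                g ∘ k                ≈⟨ ∘-resp-≈ʳ project₂ ⟨
                g ∘ (π₂ ∘ y)         ≈⟨ π₂∘second′ ⟨
                π₂ ∘ (second g ∘ y)  ∎)
            v : Hom _ _
            v = PB.universal x y fx≈y
            π₂p₂v≈k : (π₂ ∘ p₂) ∘ v ≈ k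
            π₂p₂v≈k = ≈.trans (pullʳ (PB.p₂∘universal≈h₂ x y fx≈y)) project₂

  module Quasitopos (quasitopos : IsQuasitopos 𝒞) where
    open IsQuasitopos quasitopos

    T : Obj
    T = proj₁ classifier

    open Terminal (proj₁ (proj₂ classifier))
    open Products (proj₁ (proj₂ classifier)) finiteLimits public

    Ω : Obj
    Ω = proj₁ (proj₂ (proj₂ classifier))

    true : Hom T Ω
    true = proj₁ (proj₂ (proj₂ (proj₂ classifier)))

    true-regular : IsRegularMono 𝒞 true
    true-regular = proj₁ (proj₂ (proj₂ (proj₂ (proj₂ classifier))))

    module _ {d : Hom D G} (d-regular : IsRegularMono 𝒞 d) where
      private
        classification : ∃!≈ 𝒞 (λ χ → IsPullback 𝒞 χ true d !)
        classification = proj₂ (proj₂ (proj₂ (proj₂ (proj₂ classifier)))) d d-regular !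

      characteristic : Hom G Ω
      characteristic = proj₁ classification

      characteristic-pullback : IsPullback 𝒞 characteristic true d !
      characteristic-pullback = proj₁ (proj₂ classification)

    -- Ã is the exponential π₁^true in the slice over Ω: a map G → Ã is a
    -- characteristic map χ : G → Ω together with a map from the subobject χ to A.
    module PartialMapClassifier {A Ã P : Obj} {ε : Hom Ã Ω} {p₁ : Hom P Ã} {p₂ : Hom P T}
                                {ev : Hom P (Ω ⊗ A)}
                                (exponential : IsSliceExponential 𝒞 true π₁ ε p₁ p₂ ev) where
      private
        Transpose : {Z Q : Obj} → Hom Z Ω → Hom Q Z → Hom Q T → Hom Q (Ω ⊗ A) → Hom Z Ã →
                    Set (ℓ ⊔ e)
        Transpose z q₁ q₂ h k = (ε ∘ k ≈ z) × Σ (Hom _ P) λ s →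
          (p₁ ∘ s ≈ k ∘ q₁) × (p₂ ∘ s ≈ q₂) × (ev ∘ s ≈ h)

        transpose : {Z Q : Obj} {z : Hom Z Ω} {q₁ : Hom Q Z} {q₂ : Hom Q T} →
                    IsPullback 𝒞 z true q₁ q₂ → (h : Hom Q (Ω ⊗ A)) → π₁ ∘ h ≈ z ∘ q₁ →
                    ∃!≈ 𝒞 (Transpose z q₁ q₂ h)
        transpose pullback = proj₂ (proj₂ exponential) _ _ _ pullback

        everywhere-pullback : IsPullback 𝒞 (true ∘ ! {D}) true id !
        everywhere-pullback = identityʳ ,
          λ h₁ _ _ → h₁ , (identityˡ , !-unique₂ _ _) , λ _ (id∘v≈h₁ , _) → ≈.trans (≈.sym identityˡ) id∘v≈h₁

        total-transpose : (f : Hom D A) → ∃!≈ 𝒞 (Transpose (true ∘ !) id ! ⟨ true ∘ ! , f ⟩)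
        total-transpose f = transpose everywhere-pullback ⟨ true ∘ ! , f ⟩ (≈.trans project₁ (≈.sym identityʳ))

        total : Hom D A → Hom D Ã
        total f = proj₁ (total-transpose f)

        total-unique : {f : Hom D A} {k : Hom D Ã} (s : Hom D P) →
                       ε ∘ k ≈ true ∘ ! → p₁ ∘ s ≈ k → ev ∘ s ≈ ⟨ true ∘ ! , f ⟩ → k ≈ total f
        total-unique {f = f} s εk p₁s evs =
          proj₂ (proj₂ (total-transpose f)) _ (εk , s , ≈.trans p₁s (≈.sym identityʳ) , !-unique₂ _ _ , evs)

      η : Hom A Ã
      η = total id

      private
        η-transposes : Transpose (true ∘ !) id ! ⟨ true ∘ ! , id ⟩ η
        η-transposes = proj₁ (proj₂ (total-transpose id))

      ε∘η : ε ∘ η ≈ true ∘ !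
      ε∘η = proj₁ η-transposes

      η-section : Hom A P
      η-section = proj₁ (proj₂ η-transposes)

      p₁∘η-section : p₁ ∘ η-section ≈ η
      p₁∘η-section = ≈.trans (proj₁ (proj₂ (proj₂ η-transposes))) identityʳ

      ev∘η-section : ev ∘ η-section ≈ ⟨ true ∘ ! , id ⟩
      ev∘η-section = proj₂ (proj₂ (proj₂ (proj₂ η-transposes)))

      η-retraction : (π₂ ∘ ev) ∘ η-section ≈ id
      η-retraction = ≈.trans (pullʳ ev∘η-section) project₂

      p₁-regular : IsRegularMono 𝒞 p₁
      p₁-regular = regularMono-pullback (proj₁ exponential) true-regular

      η-mono : Mono η
      η-mono = Mono-resp-≈ (≈.sym p₁∘η-section)
                 (Mono-∘ (regularMono⇒Mono p₁-regular) (section⇒Mono η-retraction))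

      private
        η∘f≈total : {f : Hom D A} → η ∘ f ≈ total f
        η∘f≈total {f = f} = total-unique (η-section ∘ f)
          (≈.trans (pullˡ ε∘η) (pullʳ (!-unique₂ _ _)))
          (pullˡ p₁∘η-section)
          (begin
            ev ∘ (η-section ∘ f)            ≈⟨ pullˡ ev∘η-section ⟩
            ⟨ true ∘ ! , id ⟩ ∘ f           ≈⟨ ⟨⟩∘ ⟩
            ⟨ (true ∘ !) ∘ f , id ∘ f ⟩     ≈⟨ ⟨⟩-cong₂ (pullʳ (!-unique₂ _ _)) identityˡ ⟩
            ⟨ true ∘ ! , f ⟩                ∎)

      module _ {d : Hom D G} (d-regular : IsRegularMono 𝒞 d) (f : Hom D A) where
        private
          χ : Hom G Ω
          χ = characteristic d-regular
          module Χ = Pullback (characteristic-pullback d-regular)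

          extension : ∃!≈ 𝒞 (Transpose χ d ! ⟨ χ ∘ d , f ⟩)
          extension = transpose (characteristic-pullback d-regular) ⟨ χ ∘ d , f ⟩ project₁

        extend : Hom G Ã
        extend = proj₁ extension

        private
          extension-transposes : Transpose χ d ! ⟨ χ ∘ d , f ⟩ extend
          extension-transposes = proj₁ (proj₂ extension)

          ε∘extend : ε ∘ extend ≈ χ
          ε∘extend = proj₁ extension-transposes

          -- both sides transpose ⟨ true ∘ ! , f ⟩ along everywhere-pullback
          extend∘d≈η∘f : extend ∘ d ≈ η ∘ f
          extend∘d≈η∘f =
            let (_ , s , p₁∘s≈extend∘d , _ , ev∘s≈⟨χ∘d,f⟩) = extension-transposes in
            ≈.trans (total-unique s (≈.trans (pullˡ ε∘extend) Χ.commute) p₁∘s≈extend∘d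
                                  (≈.trans ev∘s≈⟨χ∘d,f⟩ (⟨⟩-cong₂ Χ.commute ≈.refl)))
                    (≈.sym η∘f≈total)

        extend-pullback : IsPullback 𝒞 extend η d f
        extend-pullback = extend∘d≈η∘f , universal
          where
            universal : {X : Obj} (h : Hom X G) (y : Hom X A) → extend ∘ h ≈ η ∘ y →
                        ∃!≈ 𝒞 (λ k → (d ∘ k ≈ h) × (f ∘ k ≈ y))
            universal h y eq = k , (d∘k≈h , η-mono (begin
                η ∘ (f ∘ k)        ≈⟨ extendʳ extend∘d≈η∘f ⟨
                extend ∘ (d ∘ k)   ≈⟨ ∘-resp-≈ʳ d∘k≈h ⟩
                extend ∘ h         ≈⟨ eq ⟩
                η ∘ y              ∎)) ,
              λ v (d∘v≈h , _) → regularMono⇒Mono d-regular (≈.trans d∘v≈h (≈.sym d∘k≈h))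
              where
                χh≈true! : χ ∘ h ≈ true ∘ !
                χh≈true! = begin
                  χ ∘ h              ≈⟨ pullˡ ε∘extend ⟨
                  ε ∘ (extend ∘ h)   ≈⟨ ∘-resp-≈ʳ eq ⟩
                  ε ∘ (η ∘ y)        ≈⟨ pullˡ ε∘η ⟩
                  (true ∘ !) ∘ y     ≈⟨ pullʳ (!-unique₂ _ _) ⟩
                  true ∘ !           ∎
                k : Hom _ _
                k = Χ.universal h ! χh≈true!
                d∘k≈h : d ∘ k ≈ h
                d∘k≈h = Χ.p₁∘universal≈h₁ h ! χh≈true!

    Partial : Obj → Obj
    Partial A = proj₁ (lcc true (π₁ {Ω} {A}))

    module PartialMaps (A : Obj) = PartialMapClassifier
      (proj₂ (proj₂ (proj₂ (proj₂ (proj₂ (proj₂ (lcc true (π₁ {Ω} {A}))))))))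

    -- d ∘ s equalizes the classifying map of the partial map (d, d ∘ s ∘ r) with η.
    regularMono-∘-section : {B D G : Obj} {d : Hom D G} {s : Hom B D} {r : Hom D B} →
                            IsRegularMono 𝒞 d → r ∘ s ≈ id → IsRegularMono 𝒞 (d ∘ s)
    regularMono-∘-section {G = G} {d} {s} {r} d-regular r∘s≈id =
      Partial G , φ , η , equalize , universal
      where
        open PartialMaps G using (η; extend; extend-pullback)

        φ : Hom G (Partial G)
        φ = extend d-regular ((d ∘ s) ∘ r)

        module Φ = Pullback (extend-pullback d-regular ((d ∘ s) ∘ r))

        equalize : φ ∘ (d ∘ s) ≈ η ∘ (d ∘ s)
        equalize = begin
          φ ∘ (d ∘ s)               ≈⟨ extendʳ Φ.commute ⟩
          η ∘ (((d ∘ s) ∘ r) ∘ s)   ≈⟨ ∘-resp-≈ʳ (pullʳ r∘s≈id) ⟩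
          η ∘ ((d ∘ s) ∘ id)        ≈⟨ ∘-resp-≈ʳ identityʳ ⟩
          η ∘ (d ∘ s)               ∎

        universal : {Z : Obj} (h : Hom Z G) → φ ∘ h ≈ η ∘ h → ∃!≈ 𝒞 (λ k → (d ∘ s) ∘ k ≈ h)
        universal h eq = r ∘ k , d∘s∘r∘k≈h ,
          λ v d∘s∘v≈h → Mono-∘ (regularMono⇒Mono d-regular) (section⇒Mono r∘s≈id)
                          (≈.trans d∘s∘v≈h (≈.sym d∘s∘r∘k≈h))
          where
            k : Hom _ _
            k = Φ.universal h h eq
            d∘s∘r∘k≈h : (d ∘ s) ∘ (r ∘ k) ≈ h
            d∘s∘r∘k≈h = ≈.trans sym-assoc (Φ.p₂∘universal≈h₂ h h eq)

    -- m ≈ d ∘ ⟨ m , id ⟩ for d the (regular) pullback of t along α, and ⟨ m , id ⟩ is a section.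
    regularMono-cancelˡ : {m : Hom A G} {α : Hom G B} {t : Hom A B} →
                          IsRegularMono 𝒞 t → t ≈ α ∘ m → IsRegularMono 𝒞 m
    regularMono-cancelˡ {m = m} {α} {t} t-regular t≈α∘m with proj₂ finiteLimits α t
    ... | _ , _ , _ , pullback =
      regularMono-resp-≈ (≈.sym (PB.p₁∘universal≈h₁ m id α∘m≈t∘id))
        (regularMono-∘-section (regularMono-pullback pullback t-regular)
                               (PB.p₂∘universal≈h₂ m id α∘m≈t∘id))
      where
        module PB = Pullback pullback
        α∘m≈t∘id : α ∘ m ≈ t ∘ id
        α∘m≈t∘id = ≈.trans (≈.sym t≈α∘m) (≈.sym identityʳ)

    η-regular : {A : Obj} → IsRegularMono 𝒞 (PartialMaps.η A)
    η-regular {A} = regularMono-resp-≈ (≈.sym p₁∘η-section)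
                      (regularMono-∘-section p₁-regular η-retraction)
      where open PartialMaps A

    module Translation (ρ : PBPORule 𝒞) where
      open PBPORule ρ
      open PartialMaps L using (η; extend; extend-pullback)

      private
        interface : Σ Obj λ K₀ → Σ (Hom K₀ L) λ k₁ → Σ (Hom K₀ K') λ k₂ →
                    IsPullback 𝒞 tL l' k₁ k₂
        interface = proj₂ finiteLimits tL l'

      K₀ : Obj
      K₀ = proj₁ interface

      k₁ : Hom K₀ L
      k₁ = proj₁ (proj₂ interface)

      k₂ : Hom K₀ K'
      k₂ = proj₁ (proj₂ (proj₂ interface))

      K₀-pullback : IsPullback 𝒞 tL l' k₁ k₂
      K₀-pullback = proj₂ (proj₂ (proj₂ interface))

      module Interface = Pullback K₀-pullback

      j : Hom K K₀
      j = Interface.universal l tK commL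

      k₁∘j≈l : k₁ ∘ j ≈ l
      k₁∘j≈l = Interface.p₁∘universal≈h₁ l tK commL

      k₂∘j≈tK : k₂ ∘ j ≈ tK
      k₂∘j≈tK = Interface.p₂∘universal≈h₂ l tK commL

      private
        right : Σ Obj λ R⁺ → Σ (Hom K₀ R⁺) λ r⁺ → Σ (Hom R R⁺) λ ι → IsPushout 𝒞 j r r⁺ ι
        right = proj₂ finiteColimits j r

      R⁺ : Obj
      R⁺ = proj₁ right

      r⁺ : Hom K₀ R⁺
      r⁺ = proj₁ (proj₂ right)

      ι : Hom R R⁺
      ι = proj₁ (proj₂ (proj₂ right))

      R⁺-pushout : IsPushout 𝒞 j r r⁺ ι
      R⁺-pushout = proj₂ (proj₂ (proj₂ right))

      tL⁺ : Hom L (Partial L ⊗ L')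
      tL⁺ = ⟨ η , tL ⟩

      tK⁺ : Hom K₀ (Partial L ⊗ K')
      tK⁺ = ⟨ η ∘ k₁ , k₂ ⟩

      τ-pullback : IsPullback 𝒞 tL⁺ (second l') k₁ tK⁺
      τ-pullback = pullback-second K₀-pullback

      τ : PBPO⁺Rule 𝒞
      τ = record { L = L ; K = K₀ ; R = R⁺ ; L' = Partial L ⊗ L' ; K' = Partial L ⊗ K'
                 ; l = k₁ ; r = r⁺ ; tL = tL⁺ ; tK = tK⁺ ; l' = second l' ; pb = τ-pullback }

      private
        over-match : {GL GK : Obj} {m : Hom L GL} {α⁺ : Hom GL (Partial L ⊗ L')}
                     {gL : Hom GK GL} {u'⁺ : Hom GK (Partial L ⊗ K')} {v : Hom K₀ GK} →
                     IsPullback 𝒞 tL⁺ α⁺ id m → α⁺ ∘ gL ≈ second l' ∘ u'⁺ →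
                     u'⁺ ∘ v ≈ tK⁺ → m ∘ k₁ ≈ gL ∘ v
        over-match {α⁺ = α⁺} {gL} {u'⁺} {v} m-pullback context-commute u'⁺∘v≈tK⁺ =
          pullback-id-factor m-pullback (begin
            tL⁺ ∘ k₁                ≈⟨ proj₁ τ-pullback ⟩
            second l' ∘ tK⁺         ≈⟨ ∘-resp-≈ʳ u'⁺∘v≈tK⁺ ⟨
            second l' ∘ (u'⁺ ∘ v)   ≈⟨ extendʳ context-commute ⟨
            α⁺ ∘ (gL ∘ v)           ∎)

      monoStep⇒plusStep : {GL GR : Obj} → PBPOmonoStep 𝒞 ρ GL GR → PBPO⁺Step 𝒞 τ GL GR
      monoStep⇒plusStep {GL} (m , α , m-regular , tL≈α∘m , GK , gL , u' , context-pullback ,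
                              u , gL∘u≈m∘l , u'∘u≈tK , gR , _ , result-pushout) =
        m , α⁺ , α⁺∘m≈tL⁺ , m-pullback , GK , gL , u'⁺ , pullback-second context-pullback ,
        U , u'⁺∘U≈tK⁺ , U-unique , gR , pushout-unglue R⁺-pushout result-pushout U∘j≈u
        where
          module Context = Pullback context-pullback

          φ : Hom GL (Partial L)
          φ = extend m-regular id

          α⁺ : Hom GL (Partial L ⊗ L')
          α⁺ = ⟨ φ , α ⟩

          m-pullback : IsPullback 𝒞 tL⁺ α⁺ id m
          m-pullback = pullback-⟨⟩ (pullback-swap (extend-pullback m-regular id))
                                   (≈.trans identityʳ tL≈α∘m)

          α⁺∘m≈tL⁺ : α⁺ ∘ m ≈ tL⁺
          α⁺∘m≈tL⁺ = ≈.sym (≈.trans (≈.sym identityʳ) (proj₁ m-pullback))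

          u'⁺ : Hom GK (Partial L ⊗ K')
          u'⁺ = ⟨ φ ∘ gL , u' ⟩

          α∘m∘k₁≈l'∘k₂ : α ∘ (m ∘ k₁) ≈ l' ∘ k₂
          α∘m∘k₁≈l'∘k₂ = ≈.trans (pullˡ (≈.sym tL≈α∘m)) Interface.commute

          U : Hom K₀ GK
          U = Context.universal (m ∘ k₁) k₂ α∘m∘k₁≈l'∘k₂

          gL∘U≈m∘k₁ : gL ∘ U ≈ m ∘ k₁
          gL∘U≈m∘k₁ = Context.p₁∘universal≈h₁ (m ∘ k₁) k₂ α∘m∘k₁≈l'∘k₂

          u'∘U≈k₂ : u' ∘ U ≈ k₂
          u'∘U≈k₂ = Context.p₂∘universal≈h₂ (m ∘ k₁) k₂ α∘m∘k₁≈l'∘k₂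

          u'⁺∘U≈tK⁺ : u'⁺ ∘ U ≈ tK⁺
          u'⁺∘U≈tK⁺ = ≈.trans ⟨⟩∘ (⟨⟩-cong₂ (begin
            (φ ∘ gL) ∘ U    ≈⟨ pullʳ gL∘U≈m∘k₁ ⟩
            φ ∘ (m ∘ k₁)    ≈⟨ pullˡ (proj₁ (extend-pullback m-regular id)) ⟩
            (η ∘ id) ∘ k₁   ≈⟨ ∘-resp-≈ˡ identityʳ ⟩
            η ∘ k₁          ∎) u'∘U≈k₂)

          U-unique : (v : Hom K₀ GK) → u'⁺ ∘ v ≈ tK⁺ → v ≈ U
          U-unique v u'⁺∘v≈tK⁺ = Context.unique (m ∘ k₁) k₂ α∘m∘k₁≈l'∘k₂ v
            (≈.sym (over-match m-pullback (proj₁ (pullback-second context-pullback)) u'⁺∘v≈tK⁺))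
            (begin
              u' ∘ v            ≈⟨ project₂′ ⟨
              π₂ ∘ (u'⁺ ∘ v)    ≈⟨ ∘-resp-≈ʳ u'⁺∘v≈tK⁺ ⟩
              π₂ ∘ tK⁺          ≈⟨ project₂ ⟩
              k₂                ∎)

          U∘j≈u : U ∘ j ≈ u
          U∘j≈u = Context.unique-diagram
            (begin
              gL ∘ (U ∘ j)    ≈⟨ pullˡ gL∘U≈m∘k₁ ⟩
              (m ∘ k₁) ∘ j    ≈⟨ pullʳ k₁∘j≈l ⟩
              m ∘ l           ≈⟨ gL∘u≈m∘l ⟨
              gL ∘ u          ∎)
            (begin
              u' ∘ (U ∘ j)    ≈⟨ pullˡ u'∘U≈k₂ ⟩
              k₂ ∘ j          ≈⟨ k₂∘j≈tK ⟩
              tK              ≈⟨ u'∘u≈tK ⟨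
              u' ∘ u          ∎)

      plusStep⇒monoStep : {GL GR : Obj} → PBPO⁺Step 𝒞 τ GL GR → PBPOmonoStep 𝒞 ρ GL GR
      plusStep⇒monoStep (m , α⁺ , α⁺∘m≈tL⁺ , m-pullback , GK , gL , u'⁺ , context-pullback⁺ ,
                         U , u'⁺∘U≈tK⁺ , _ , gR , w⁺ , result-pushout⁺) =
        m , π₂ ∘ α⁺ , m-regular , tL≈α∘m , GK , gL , π₂ ∘ u'⁺ ,
        pullback-second⁻¹ context-pullback⁺ ,
        U ∘ j , gL∘U∘j≈m∘l , u'∘U∘j≈tK , gR , w⁺ ∘ ι , pushout-glue R⁺-pushout result-pushout⁺
        where
          m-regular : IsRegularMono 𝒞 m
          m-regular = regularMono-cancelˡ η-regular (≈.sym (≈.trans (pullʳ α⁺∘m≈tL⁺) project₁))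

          tL≈α∘m : tL ≈ (π₂ ∘ α⁺) ∘ m
          tL≈α∘m = ≈.sym (≈.trans (pullʳ α⁺∘m≈tL⁺) project₂)

          gL∘U∘j≈m∘l : gL ∘ (U ∘ j) ≈ m ∘ l
          gL∘U∘j≈m∘l = begin
            gL ∘ (U ∘ j)   ≈⟨ pullˡ (≈.sym (over-match m-pullback (proj₁ context-pullback⁺) u'⁺∘U≈tK⁺)) ⟩
            (m ∘ k₁) ∘ j   ≈⟨ pullʳ k₁∘j≈l ⟩
            m ∘ l          ∎

          u'∘U∘j≈tK : (π₂ ∘ u'⁺) ∘ (U ∘ j) ≈ tK
          u'∘U∘j≈tK = begin
            (π₂ ∘ u'⁺) ∘ (U ∘ j)   ≈⟨ pullʳ (pullˡ u'⁺∘U≈tK⁺) ⟩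
            π₂ ∘ (tK⁺ ∘ j)         ≈⟨ project₂′ ⟩
            k₂ ∘ j                 ≈⟨ k₂∘j≈tK ⟩
            tK                     ∎

      mono-steps≐τ-steps : _≐_ 𝒞 (PBPOmonoStep 𝒞 ρ) (PBPO⁺Step 𝒞 τ)
      mono-steps≐τ-steps _ _ = monoStep⇒plusStep , plusStep⇒monoStep

      steps≐τ-steps : IsRegularMono 𝒞 tL → _≐_ 𝒞 (PBPOStep 𝒞 ρ) (PBPO⁺Step 𝒞 τ)
      steps≐τ-steps tL-regular _ _ =
        (λ (m , α , step) →
          monoStep⇒plusStep (m , α , regularMono-cancelˡ tL-regular (proj₁ step) , step)) ,
        (λ plus → let (m , α , _ , step) = plusStep⇒monoStep plus in m , α , step)

corollary4 : ∀ {o ℓ e : Level} (𝒞 : Category o ℓ e) → IsQuasitopos 𝒞 →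
    (ρ : PBPORule 𝒞) →
      (Σ (PBPO⁺Rule 𝒞) λ τ → _≐_ 𝒞 (PBPOmonoStep 𝒞 ρ) (PBPO⁺Step 𝒞 τ)) ×
      (IsRegularMono 𝒞 (PBPORule.tL ρ) →
        Σ (PBPO⁺Rule 𝒞) λ τ → _≐_ 𝒞 (PBPOStep 𝒞 ρ) (PBPO⁺Step 𝒞 τ))
corollary4 𝒞 quasitopos ρ =
  (τ , mono-steps≐τ-steps) , λ tL-regular → τ , steps≐τ-steps tL-regular
  where
    open Quasitopos 𝒞 quasitopos
    open Translation ρ
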